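{- Let $M$ be a finite matroid having at least one circuit, and let $d$ be the size of its largest circuit. Then $\mathrm{bd}(M)\ge\log_2 d$.
   Context: Depth of a rooted tree: the number of edges of a longest root-to-leaf path; $\|T\|$ is the number of edges of $T$. A depth-decomposition of a finite matroid $M$ with rank function $r$ is a pair $(T,f)$, $T$ a rooted tree, $f:M\to V(T)$, such that (1) $r(M)=\|T\|$ and (2) $r(X)\le\|T^*(X)\|$ for all $X\subseteq M$, where $T^*(X)$ is the union of the paths from the root to the vertices of $f(X)$. The branch-depth $\mathrm{bd}(M)$ is the smallest depth of a rooted tree $T$ for which some $(T,f)$ is a depth-decomposition of $M$. -}

module Defs where

open import Data.Nat using (ℕ; zero; suc; _+_; _≤_; _<_; _^_)
open import Data.Fin using (Fin; zero; suc; toℕ)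
open import Data.Fin.Subset using (Subset; _∈_; _⊆_; _⊂_; _∩_; _∪_; ∣_∣; ⊤)
open import Data.Product using (Σ; ∃; ∃-syntax; _×_; _,_)
open import Relation.Binary.PropositionalEquality using (_≡_)
open import Function.Bundles using (_⇔_)

record Matroid : Set where
  field
    n         : ℕ
    r         : Subset n → ℕ
    r-bounded : ∀ X → r X ≤ ∣ X ∣
    r-mono    : ∀ {X Y} → X ⊆ Y → r X ≤ r Y
    r-submod  : ∀ X Y → r (X ∪ Y) + r (X ∩ Y) ≤ r X + r Y

open Matroid public

Dependent : (M : Matroid) → Subset (n M) → Set
Dependent M X = r M X < ∣ X ∣

Independent : (M : Matroid) → Subset (n M) → Set
Independent M X = r M X ≡ ∣ X ∣

IsCircuit : (M : Matroid) → Subset (n M) → Set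
IsCircuit M C = Dependent M C × (∀ Y → Y ⊂ C → Independent M Y)

HasCircuit : Matroid → Set
HasCircuit M = ∃[ C ] IsCircuit M C

LargestCircuitSize : Matroid → ℕ → Set
LargestCircuitSize M d =
  (∃[ C ] (IsCircuit M C × ∣ C ∣ ≡ d)) × (∀ C → IsCircuit M C → ∣ C ∣ ≤ d)

-- Finite rooted trees with k edges: vertices Fin (suc k), root zero,
-- the non-root vertex (suc i) has parent (parent i), whose index is
-- smaller than that of suc i (every finite rooted tree has such a
-- labelling, e.g. in BFS order).

record RootedTree : Set where
  field
    edges     : ℕ
    parent    : Fin edges → Fin (suc edges)
    parent-lt : ∀ i → toℕ (parent i) ≤ toℕ i

open RootedTree public

Vertex : RootedTree → Set
Vertex T = Fin (suc (edges T))

data Anc (T : RootedTree) (u : Vertex T) : Vertex T → Set where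
  here : Anc T u u
  up   : ∀ {i} → Anc T u (parent T i) → Anc T u (suc i)

data PathLen (T : RootedTree) : Vertex T → ℕ → Set where
  root : PathLen T zero 0
  step : ∀ {i l} → PathLen T (parent T i) l → PathLen T (suc i) (suc l)

Depth : RootedTree → ℕ → Set
Depth T h =
  (∀ v → ∃[ l ] (PathLen T v l × l ≤ h)) × (∃[ v ] PathLen T v h)

-- The edge set of T*(X), identified with the set of non-root vertices
-- (suc i) lying on a root path to some f(x), x ∈ X.  Each edge of T is
-- identified with its lower endpoint.
IsTStar : (M : Matroid) (T : RootedTree) (f : Fin (n M) → Vertex T) →
          Subset (n M) → Subset (edges T) → Set
IsTStar M T f X S = ∀ i → (i ∈ S ⇔ (∃[ x ] (x ∈ X × Anc T (suc i) (f x))))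

record DepthDecomposition (M : Matroid) (T : RootedTree) : Set where
  field
    f     : Fin (n M) → Vertex T
    rankM : r M ⊤ ≡ edges T
    rankX : ∀ X S → IsTStar M T f X S → r M X ≤ ∣ S ∣

IsBranchDepth : Matroid → ℕ → Set
IsBranchDepth M b =
  (∃[ T ] (DepthDecomposition M T × Depth T b)) ×
  (∀ T h → DepthDecomposition M T → Depth T h → b ≤ h)

-- Let (T, f) be a depth-decomposition of depth b and C a circuit.  Extending C − x₀ to a
-- basis B and putting D = B + x₀, every D − c with c ∈ C is a basis, so by the rank
-- condition it satisfies Hall's condition for matching its elements to the edges of T,
-- each element to an edge on the root path of its image (matchings are represented by
-- Hall's condition throughout).  Call R ⊆ D a complement for an edge set F if D − R matches
-- perfectly onto F; the singletons {c}, c ∈ C, are complements for all edges.  The heart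
-- of the proof is the count: if every root path meets F in at most h edges, then the union
-- of all complements has at most |R| · 2^h elements, for any complement R.  By induction
-- on |D| + |F|, take a topmost edge e of F.  If some element's path avoids e, the instance
-- separates into the elements through e with the edges below e, and the rest.  Otherwise
-- e lies on every path, and each complement R grows to a complement R + y for F − e (y being
-- the partner of e in a matching); h drops by one while |R| grows by one, and 1 + |R| ≤ 2|R|.
-- With R = {x₀} this gives |C| ≤ 2^b.

module Submission where

open import Data.Nat using (ℕ; zero; suc; _+_; _*_; _^_; _≤_; _<_; z≤n; s≤s; _≤?_; _<?_)
open import Data.Nat.Properties hiding (_≟_)
open import Data.Fin using (Fin; zero; suc; toℕ)
open import Data.Fin.Properties using (_≟_; any?; toℕ-injective)
open import Data.Fin.Subset
open import Data.Fin.Subset.Properties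
open import Data.Fin.Subset.Induction using (⊂-wellFounded; Acc; acc)
open import Data.Vec using ([]; _∷_; here; there)
open import Data.Product using (∃; _×_; _,_; proj₁; proj₂)
open import Data.Sum as Sum using (_⊎_; inj₁; inj₂; [_,_]′)
open import Function using (_∘_; id)
open import Function.Bundles using (_⇔_; mk⇔; module Equivalence)
open import Relation.Nullary using (Dec; yes; no; does; ¬_; contradiction)
open import Relation.Nullary.Decidable using (_×-dec_)
open import Relation.Binary.PropositionalEquality
  using (_≡_; refl; sym; trans; cong; cong₂; subst; module ≡-Reasoning)

open import Defs

private
  variable
    k : ℕ
    x : Fin k
    p q : Subset k

-- Subsets of Fin k

∣p∣≡∣p∩q∣+∣p─q∣ : ∀ (p q : Subset k) → ∣ p ∣ ≡ ∣ p ∩ q ∣ + ∣ p ─ q ∣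
∣p∣≡∣p∩q∣+∣p─q∣ []            []            = refl
∣p∣≡∣p∩q∣+∣p─q∣ (inside  ∷ p) (inside  ∷ q) = cong suc (∣p∣≡∣p∩q∣+∣p─q∣ p q)
∣p∣≡∣p∩q∣+∣p─q∣ (inside  ∷ p) (outside ∷ q) = trans (cong suc (∣p∣≡∣p∩q∣+∣p─q∣ p q)) (sym (+-suc _ _))
∣p∣≡∣p∩q∣+∣p─q∣ (outside ∷ p) (inside  ∷ q) = ∣p∣≡∣p∩q∣+∣p─q∣ p q
∣p∣≡∣p∩q∣+∣p─q∣ (outside ∷ p) (outside ∷ q) = ∣p∣≡∣p∩q∣+∣p─q∣ p q

∣p∪q∣+∣p∩q∣≡∣p∣+∣q∣ : ∀ (p q : Subset k) → ∣ p ∪ q ∣ + ∣ p ∩ q ∣ ≡ ∣ p ∣ + ∣ q ∣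
∣p∪q∣+∣p∩q∣≡∣p∣+∣q∣ []            []            = refl
∣p∪q∣+∣p∩q∣≡∣p∣+∣q∣ (inside  ∷ p) (inside  ∷ q) =
  cong suc (trans (+-suc _ _) (trans (cong suc (∣p∪q∣+∣p∩q∣≡∣p∣+∣q∣ p q)) (sym (+-suc _ _))))
∣p∪q∣+∣p∩q∣≡∣p∣+∣q∣ (inside  ∷ p) (outside ∷ q) = cong suc (∣p∪q∣+∣p∩q∣≡∣p∣+∣q∣ p q)
∣p∪q∣+∣p∩q∣≡∣p∣+∣q∣ (outside ∷ p) (inside  ∷ q) = trans (cong suc (∣p∪q∣+∣p∩q∣≡∣p∣+∣q∣ p q)) (sym (+-suc _ _))
∣p∪q∣+∣p∩q∣≡∣p∣+∣q∣ (outside ∷ p) (outside ∷ q) = ∣p∪q∣+∣p∩q∣≡∣p∣+∣q∣ p q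

∣p∪q∣≤∣p∣+∣q∣ : ∀ (p q : Subset k) → ∣ p ∪ q ∣ ≤ ∣ p ∣ + ∣ q ∣
∣p∪q∣≤∣p∣+∣q∣ p q = ≤-trans (m≤m+n _ _) (≤-reflexive (∣p∪q∣+∣p∩q∣≡∣p∣+∣q∣ p q))

x∈p⇒∣p∣≡1+∣p-x∣ : x ∈ p → ∣ p ∣ ≡ suc ∣ p - x ∣
x∈p⇒∣p∣≡1+∣p-x∣ {p = inside ∷ p}  here      = cong suc (sym (cong ∣_∣ (p─⊥≡p p)))
x∈p⇒∣p∣≡1+∣p-x∣ {p = inside ∷ p}  (there i) = cong suc (x∈p⇒∣p∣≡1+∣p-x∣ i)
x∈p⇒∣p∣≡1+∣p-x∣ {p = outside ∷ p} (there i) = x∈p⇒∣p∣≡1+∣p-x∣ i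

x∉p⇒∣p∪⁅x⁆∣≡1+∣p∣ : x ∉ p → ∣ p ∪ ⁅ x ⁆ ∣ ≡ suc ∣ p ∣
x∉p⇒∣p∪⁅x⁆∣≡1+∣p∣ {x = zero}  {outside ∷ p} x∉p = cong suc (cong ∣_∣ (∪-identityʳ p))
x∉p⇒∣p∪⁅x⁆∣≡1+∣p∣ {x = zero}  {inside  ∷ p} x∉p = contradiction here x∉p
x∉p⇒∣p∪⁅x⁆∣≡1+∣p∣ {x = suc x} {inside  ∷ p} x∉p = cong suc (x∉p⇒∣p∪⁅x⁆∣≡1+∣p∣ (x∉p ∘ there))
x∉p⇒∣p∪⁅x⁆∣≡1+∣p∣ {x = suc x} {outside ∷ p} x∉p = x∉p⇒∣p∪⁅x⁆∣≡1+∣p∣ (x∉p ∘ there)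

x∈p⇒0<∣p∣ : x ∈ p → 0 < ∣ p ∣
x∈p⇒0<∣p∣ x∈p = ≤-<-trans z≤n (x∈p⇒∣p-x∣<∣p∣ x∈p)

Empty⇒∣p∣≡0 : Empty p → ∣ p ∣ ≡ 0
Empty⇒∣p∣≡0 {k} p-empty rewrite Empty-unique p-empty = ∣⊥∣≡0 k

0<∣p∣⇒Nonempty : 0 < ∣ p ∣ → Nonempty p
0<∣p∣⇒Nonempty {p = p} 0<∣p∣ with nonempty? p
... | yes p-nonempty = p-nonempty
... | no  p-empty    = contradiction (Empty⇒∣p∣≡0 p-empty) (λ ∣p∣≡0 → <⇒≱ 0<∣p∣ (≤-reflexive ∣p∣≡0))

∣p∣+∣∁p∣≡n : ∀ (p : Subset k) → ∣ p ∣ + ∣ ∁ p ∣ ≡ k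
∣p∣+∣∁p∣≡n {k} p = trans (cong (∣ p ∣ +_) (∣∁p∣≡n∸∣p∣ p)) (m+[n∸m]≡n (∣p∣≤n p))

x∈p─q⁻ : ∀ (p q : Subset k) → x ∈ p ─ q → x ∈ p × x ∉ q
x∈p─q⁻ p q x∈p─q = p─q⊆p p q x∈p─q , x∉q p q x∈p─q
  where
  x∉q : ∀ (p q : Subset k) → x ∈ p ─ q → x ∉ q
  x∉q (_ ∷ p) (inside ∷ q) () here
  x∉q (_ ∷ p) (_      ∷ q) (there x∈p─q) (there x∈q) = x∉q p q x∈p─q x∈q

p⊆q∧∣q∣≤∣p∣⇒q⊆p : p ⊆ q → ∣ q ∣ ≤ ∣ p ∣ → q ⊆ p
p⊆q∧∣q∣≤∣p∣⇒q⊆p {p = p} {q} p⊆q ∣q∣≤∣p∣ {x} x∈q with x ∈? p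
... | yes x∈p = x∈p
... | no  x∉p = contradiction ∣q∣≤∣p∣ (<⇒≱ (p⊂q⇒∣p∣<∣q∣ (p⊆q , x , x∈q , x∉p)))

x∈p⇒⁅x⁆⊆p : x ∈ p → ⁅ x ⁆ ⊆ p
x∈p⇒⁅x⁆⊆p {x = x} {p = p} x∈p y∈⁅x⁆ = subst (_∈ p) (sym (x∈⁅y⁆⇒x≡y x y∈⁅x⁆)) x∈p

p-x⊆q⇒p⊆q∪⁅x⁆ : p - x ⊆ q → p ⊆ q ∪ ⁅ x ⁆
p-x⊆q⇒p⊆q∪⁅x⁆ {x = x} {q = q} p-x⊆q {y} y∈p with y ≟ x
... | yes refl = q⊆p∪q q _ (x∈⁅x⁆ y)
... | no  y≢x  = p⊆p∪q _ (p-x⊆q (x∈p∧x≢y⇒x∈p-y y∈p y≢x))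

p⊆r∧q⊆r⇒p∪q⊆r : ∀ {p q r : Subset k} → p ⊆ r → q ⊆ r → p ∪ q ⊆ r
p⊆r∧q⊆r⇒p∪q⊆r {p = p} {q} p⊆r q⊆r x∈ = [ p⊆r , q⊆r ]′ (x∈p∪q⁻ p q x∈)

p∩[q∩r]⊆p∩r : ∀ {p q r : Subset k} → p ∩ (q ∩ r) ⊆ p ∩ r
p∩[q∩r]⊆p∩r {p = p} {q} {r} x∈ =
  x∈p∩q⁺ (proj₁ (x∈p∩q⁻ p _ x∈) , proj₂ (x∈p∩q⁻ q r (proj₂ (x∈p∩q⁻ p _ x∈))))

p∩[q─r]⊆p─r : ∀ {p q r : Subset k} → p ∩ (q ─ r) ⊆ p ─ r
p∩[q─r]⊆p─r {p = p} {q} {r} x∈ =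
  x∈p∧x∉q⇒x∈p─q (proj₁ (x∈p∩q⁻ p _ x∈)) (proj₂ (x∈p─q⁻ q r (proj₂ (x∈p∩q⁻ p _ x∈))))

Empty[p─q]⇒p⊆q : Empty (p ─ q) → p ⊆ q
Empty[p─q]⇒p⊆q {q = q} p─q-empty {x} x∈p with x ∈? q
... | yes x∈q = x∈q
... | no  x∉q = contradiction (x , x∈p∧x∉q⇒x∈p─q x∈p x∉q) p─q-empty

Nonempty[p─q]⇒∣p∩q∣<∣p∣ : ∀ (p q : Subset k) → Nonempty (p ─ q) → ∣ p ∩ q ∣ < ∣ p ∣
Nonempty[p─q]⇒∣p∩q∣<∣p∣ p q (_ , x∈p─q) =
  subst (∣ p ∩ q ∣ <_) (sym (∣p∣≡∣p∩q∣+∣p─q∣ p q)) (m<m+n ∣ p ∩ q ∣ (x∈p⇒0<∣p∣ x∈p─q))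

≤-by-Nonempty : ∀ {n} → (Nonempty p → ∣ p ∣ ≤ n) → ∣ p ∣ ≤ n
≤-by-Nonempty {p = p} bound with nonempty? p
... | yes p-nonempty = bound p-nonempty
... | no  p-empty    = subst (_≤ _) (sym (Empty⇒∣p∣≡0 p-empty)) z≤n

p∩[q─r]≡[p∩q]─r : ∀ (p q r : Subset k) → p ∩ (q ─ r) ≡ p ∩ q ─ r
p∩[q─r]≡[p∩q]─r p q r = ⊆-antisym forth back
  where
  forth : p ∩ (q ─ r) ⊆ p ∩ q ─ r
  forth x∈ with x∈p∩q⁻ p (q ─ r) x∈
  ... | x∈p , x∈q─r with x∈p─q⁻ q r x∈q─r
  ... | x∈q , x∉r = x∈p∧x∉q⇒x∈p─q (x∈p∩q⁺ (x∈p , x∈q)) x∉r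
  back : p ∩ q ─ r ⊆ p ∩ (q ─ r)
  back x∈ with x∈p─q⁻ (p ∩ q) r x∈
  ... | x∈p∩q , x∉r with x∈p∩q⁻ p q x∈p∩q
  ... | x∈p , x∈q = x∈p∩q⁺ (x∈p , x∈p∧x∉q⇒x∈p─q x∈q x∉r)

[p∩r]─[q∩r]≡[p─q]∩r : ∀ (p q r : Subset k) → p ∩ r ─ q ∩ r ≡ (p ─ q) ∩ r
[p∩r]─[q∩r]≡[p─q]∩r p q r = ⊆-antisym forth back
  where
  forth : p ∩ r ─ q ∩ r ⊆ (p ─ q) ∩ r
  forth x∈ with x∈p─q⁻ (p ∩ r) (q ∩ r) x∈
  ... | x∈p∩r , x∉q∩r with x∈p∩q⁻ p r x∈p∩r
  ... | x∈p , x∈r = x∈p∩q⁺ (x∈p∧x∉q⇒x∈p─q x∈p (λ x∈q → x∉q∩r (x∈p∩q⁺ (x∈q , x∈r))) , x∈r)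
  back : (p ─ q) ∩ r ⊆ p ∩ r ─ q ∩ r
  back x∈ with x∈p∩q⁻ (p ─ q) r x∈
  ... | x∈p─q , x∈r with x∈p─q⁻ p q x∈p─q
  ... | x∈p , x∉q = x∈p∧x∉q⇒x∈p─q (x∈p∩q⁺ (x∈p , x∈r)) (x∉q ∘ proj₁ ∘ x∈p∩q⁻ q r)

[p─r]─[q─r]≡[p─q]─r : ∀ (p q r : Subset k) → (p ─ r) ─ (q ─ r) ≡ (p ─ q) ─ r
[p─r]─[q─r]≡[p─q]─r p q r = ⊆-antisym forth back
  where
  forth : (p ─ r) ─ (q ─ r) ⊆ (p ─ q) ─ r
  forth x∈ with x∈p─q⁻ (p ─ r) (q ─ r) x∈
  ... | x∈p─r , x∉q─r with x∈p─q⁻ p r x∈p─r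
  ... | x∈p , x∉r = x∈p∧x∉q⇒x∈p─q (x∈p∧x∉q⇒x∈p─q x∈p (λ x∈q → x∉q─r (x∈p∧x∉q⇒x∈p─q x∈q x∉r))) x∉r
  back : (p ─ q) ─ r ⊆ (p ─ r) ─ (q ─ r)
  back x∈ with x∈p─q⁻ (p ─ q) r x∈
  ... | x∈p─q , x∉r with x∈p─q⁻ p q x∈p─q
  ... | x∈p , x∉q = x∈p∧x∉q⇒x∈p─q (x∈p∧x∉q⇒x∈p─q x∈p x∉r) (x∉q ∘ p─q⊆p q r)

select : {P : Fin k → Set} → (∀ i → Dec (P i)) → Subset k
select {k = zero}  P? = []
select {k = suc k} P? = does (P? zero) ∷ select (P? ∘ suc)

∈-select⁺ : {P : Fin k → Set} (P? : ∀ i → Dec (P i)) → P x → x ∈ select P?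
∈-select⁺ {x = zero}  P? Px with P? zero
... | yes _   = here
... | no  ¬Px = contradiction Px ¬Px
∈-select⁺ {x = suc x} P? Px = there (∈-select⁺ (P? ∘ suc) Px)

∈-select⁻ : {P : Fin k → Set} (P? : ∀ i → Dec (P i)) → x ∈ select P? → P x
∈-select⁻ {x = zero}  P? x∈ with P? zero | x∈
... | yes Px | _  = Px
... | no  _  | ()
∈-select⁻ {x = suc x} P? (there x∈) = ∈-select⁻ (P? ∘ suc) x∈

minimal-by : {Q : Subset k → Set} (μ : Subset k → ℕ) → (∀ p → Dec (Q p)) → ∀ p → Q p →
             ∃ λ p* → Q p* × (∀ q → Q q → μ p* ≤ μ q)
minimal-by {Q = Q} μ Q? p Qp = descend (μ p) p Qp ≤-refl
  where
  descend : ∀ fuel p → Q p → μ p ≤ fuel → ∃ λ p* → Q p* × (∀ q → Q q → μ p* ≤ μ q)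
  descend fuel p Qp μp≤fuel with anySubset? (λ q → Q? q ×-dec (μ q <? μ p))
  ... | no  none-smaller = p , Qp , λ q Qq → ≮⇒≥ (λ μq<μp → none-smaller (q , Qq , μq<μp))
  descend zero       p Qp μp≤0      | yes (q , Qq , μq<μp) = contradiction (≤-trans μq<μp μp≤0) λ ()
  descend (suc fuel) p Qp μp≤1+fuel | yes (q , Qq , μq<μp) = descend fuel q Qq (≤-pred (≤-trans μq<μp μp≤1+fuel))

min-index : Nonempty p → ∃ λ e → e ∈ p × (∀ {j} → j ∈ p → toℕ e ≤ toℕ j)
min-index {p = inside  ∷ p} _                 = zero , here , λ _ → z≤n
min-index {p = outside ∷ p} (suc x , there x∈p) with min-index (x , x∈p)
... | e , e∈p , e-min = suc e , there e∈p , λ { (there j∈p) → s≤s (e-min j∈p) }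

m≤o∧n≤p∧o+p≤m+n⇒m≡o∧n≡p : ∀ {m n o p} → m ≤ o → n ≤ p → o + p ≤ m + n → m ≡ o × n ≡ p
m≤o∧n≤p∧o+p≤m+n⇒m≡o∧n≡p {m} {n} {o} {p} m≤o n≤p o+p≤m+n =
  ≤-antisym m≤o (+-cancelʳ-≤ p o m (≤-trans o+p≤m+n (+-monoʳ-≤ m n≤p))) ,
  ≤-antisym n≤p (+-cancelˡ-≤ o p n (≤-trans o+p≤m+n (+-monoˡ-≤ n m≤o)))

n≤n*2^h : ∀ n h → n ≤ n * 2 ^ h
n≤n*2^h n h = ≤-trans (≤-reflexive (sym (*-identityʳ n))) (*-monoʳ-≤ n (m^n>0 2 h))

[1+n]*a≤n*[2*a] : ∀ {n} a → 0 < n → suc n * a ≤ n * (2 * a)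
[1+n]*a≤n*[2*a] {suc n} a _ = ≤-trans (*-monoˡ-≤ a (s≤s (s≤s (m≤m*n n 2)))) (≤-reflexive (*-assoc (suc n) 2 a))

-- Elements x of Fin N are given root paths `path x`, and `subtree e` is the set of edges
-- at or below e; edges are indexed so that an edge precedes every edge below it.
module PathCounting
  {N m : ℕ} (path : Fin N → Subset m) (subtree : Fin m → Subset m)
  (∈-subtree     : ∀ e → e ∈ subtree e)
  (path-upward   : ∀ x {e j} → j ∈ path x → j ∈ subtree e → e ∈ path x)
  (path-chain    : ∀ x {e j} → e ∈ path x → j ∈ path x → j ∈ subtree e ⊎ e ∈ subtree j)
  (subtree-index : ∀ {e j} → j ∈ subtree e → toℕ e ≤ toℕ j)
  where

  paths : Subset N → Subset m
  paths I = select (λ j → any? (λ x → (x ∈? I) ×-dec (j ∈? path x)))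

  ∈-paths⁺ : ∀ {I x j} → x ∈ I → j ∈ path x → j ∈ paths I
  ∈-paths⁺ {I} x∈I j∈path = ∈-select⁺ (λ j → any? (λ x → (x ∈? I) ×-dec (j ∈? path x))) (_ , x∈I , j∈path)

  ∈-paths⁻ : ∀ {I j} → j ∈ paths I → ∃ λ x → x ∈ I × j ∈ path x
  ∈-paths⁻ {I} = ∈-select⁻ (λ j → any? (λ x → (x ∈? I) ×-dec (j ∈? path x)))

  neighbours : Subset m → Subset N → Subset m
  neighbours F I = paths I ∩ F

  Hall : Subset m → Subset N → Set
  Hall F Q = ∀ I → I ⊆ Q → ∣ I ∣ ≤ ∣ neighbours F I ∣

  Perfect : Subset m → Subset N → Set
  Perfect F Q = ∣ Q ∣ ≡ ∣ F ∣ × Hall F Q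

  Hall⇒∣Q∣≤∣F∣ : ∀ {F Q} → Hall F Q → ∣ Q ∣ ≤ ∣ F ∣
  Hall⇒∣Q∣≤∣F∣ {F} {Q} hall = ≤-trans (hall Q id) (∣p∩q∣≤∣q∣ (paths Q) F)

  Hall-restrict : ∀ {F F' Q Q'} → Hall F Q → Q' ⊆ Q →
                  (∀ {x j} → x ∈ Q' → j ∈ path x → j ∈ F → j ∈ F') → Hall F' Q'
  Hall-restrict {F} {F'} hall Q'⊆Q restricts I I⊆Q' =
    ≤-trans (hall I (Q'⊆Q ∘ I⊆Q')) (p⊆q⇒∣p∣≤∣q∣ neighbours-restrict)
    where
    neighbours-restrict : neighbours F I ⊆ neighbours F' I
    neighbours-restrict j∈ with x∈p∩q⁻ (paths I) F j∈
    ... | j∈paths , j∈F with ∈-paths⁻ j∈paths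
    ... | x , x∈I , j∈path = x∈p∩q⁺ (j∈paths , restricts (I⊆Q' x∈I) j∈path j∈F)

  Separates : Subset N → Subset m → Subset m → Set
  Separates T S F = ∀ {x j} → j ∈ path x → j ∈ F → x ∈ T ⇔ j ∈ S

  perfect-split : ∀ {F Q} T S → Separates T S F → Perfect F Q →
                  Perfect (F ∩ S) (Q ∩ T) × Perfect (F ─ S) (Q ─ T)
  perfect-split {F} {Q} T S separates (∣Q∣≡∣F∣ , hall) =
    (proj₁ sizes , hall-in) , (proj₂ sizes , hall-out)
    where
    hall-in : Hall (F ∩ S) (Q ∩ T)
    hall-in = Hall-restrict hall (p∩q⊆p Q T) λ x∈ j∈path j∈F →
      x∈p∩q⁺ (j∈F , Equivalence.to (separates j∈path j∈F) (proj₂ (x∈p∩q⁻ Q T x∈)))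
    hall-out : Hall (F ─ S) (Q ─ T)
    hall-out = Hall-restrict hall (p─q⊆p Q T) λ x∈ j∈path j∈F →
      x∈p∧x∉q⇒x∈p─q j∈F (proj₂ (x∈p─q⁻ Q T x∈) ∘ Equivalence.from (separates j∈path j∈F))
    sizes : ∣ Q ∩ T ∣ ≡ ∣ F ∩ S ∣ × ∣ Q ─ T ∣ ≡ ∣ F ─ S ∣
    sizes = m≤o∧n≤p∧o+p≤m+n⇒m≡o∧n≡p (Hall⇒∣Q∣≤∣F∣ hall-in) (Hall⇒∣Q∣≤∣F∣ hall-out) (begin
      ∣ F ∩ S ∣ + ∣ F ─ S ∣  ≡⟨ ∣p∣≡∣p∩q∣+∣p─q∣ F S ⟨
      ∣ F ∣                  ≡⟨ ∣Q∣≡∣F∣ ⟨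
      ∣ Q ∣                  ≡⟨ ∣p∣≡∣p∩q∣+∣p─q∣ Q T ⟩
      ∣ Q ∩ T ∣ + ∣ Q ─ T ∣  ∎)
      where open ≤-Reasoning

  neighbours-∪ : ∀ F I J → neighbours F (I ∪ J) ⊆ neighbours F I ∪ neighbours F J
  neighbours-∪ F I J j∈ with x∈p∩q⁻ (paths (I ∪ J)) F j∈
  ... | j∈paths , j∈F with ∈-paths⁻ j∈paths
  ... | x , x∈I∪J , j∈path with x∈p∪q⁻ I J x∈I∪J
  ... | inj₁ x∈I = x∈p∪q⁺ (inj₁ (x∈p∩q⁺ (∈-paths⁺ x∈I j∈path , j∈F)))
  ... | inj₂ x∈J = x∈p∪q⁺ (inj₂ (x∈p∩q⁺ (∈-paths⁺ x∈J j∈path , j∈F)))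

  neighbours-∩ : ∀ F I J → neighbours F (I ∩ J) ⊆ neighbours F I ∩ neighbours F J
  neighbours-∩ F I J j∈ with x∈p∩q⁻ (paths (I ∩ J)) F j∈
  ... | j∈paths , j∈F with ∈-paths⁻ j∈paths
  ... | x , x∈I∩J , j∈path with x∈p∩q⁻ I J x∈I∩J
  ... | x∈I , x∈J = x∈p∩q⁺ (x∈p∩q⁺ (∈-paths⁺ x∈I j∈path , j∈F) , x∈p∩q⁺ (∈-paths⁺ x∈J j∈path , j∈F))

  perfect-remove : ∀ {F Q e} → Perfect F Q → e ∈ F → (∀ {x} → x ∈ Q → e ∈ path x) →
                   ∃ λ y → y ∈ Q × Perfect (F - e) (Q - y)
  perfect-remove {F} {Q} {e} (∣Q∣≡∣F∣ , hall) e∈F through-e = y , y∈Q , ∣Q-y∣≡∣F-e∣ , hall-Q-y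
    where
    -- Tight sets are closed under intersection, so the smallest one lies inside every
    -- tight set; removing one of its elements y leaves no tight subset of Q − y, which is
    -- Hall's condition for F − e.
    Tight : Subset N → Set
    Tight I = I ⊆ Q × Nonempty I × ∣ neighbours F I ∣ ≤ ∣ I ∣

    tight? : ∀ I → Dec (Tight I)
    tight? I = (I ⊆? Q) ×-dec (nonempty? I ×-dec (∣ neighbours F I ∣ ≤? ∣ I ∣))

    e∈neighbours : ∀ {I} → I ⊆ Q → Nonempty I → e ∈ neighbours F I
    e∈neighbours I⊆Q (x , x∈I) = x∈p∩q⁺ (∈-paths⁺ x∈I (through-e (I⊆Q x∈I)) , e∈F)

    Q-tight : Tight Q
    Q-tight = id , 0<∣p∣⇒Nonempty (subst (0 <_) (sym ∣Q∣≡∣F∣) (x∈p⇒0<∣p∣ e∈F)) ,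
              subst (∣ neighbours F Q ∣ ≤_) (sym ∣Q∣≡∣F∣) (∣p∩q∣≤∣q∣ (paths Q) F)

    tight-∩ : ∀ {I J} → Tight I → Tight J → Tight (I ∩ J)
    tight-∩ {I} {J} (I⊆Q , I≠∅ , I-tight) (J⊆Q , J≠∅ , J-tight) =
      I⊆Q ∘ p∩q⊆p I J ,
      0<∣p∣⇒Nonempty (≤-trans (x∈p⇒0<∣p∣ e∈A∩B) ∣A∩B∣≤∣I∩J∣) ,
      ≤-trans (p⊆q⇒∣p∣≤∣q∣ (neighbours-∩ F I J)) ∣A∩B∣≤∣I∩J∣
      where
      A = neighbours F I
      B = neighbours F J
      e∈A∩B : e ∈ A ∩ B
      e∈A∩B = x∈p∩q⁺ (e∈neighbours I⊆Q I≠∅ , e∈neighbours J⊆Q J≠∅)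
      I∪J⊆Q : I ∪ J ⊆ Q
      I∪J⊆Q = p⊆r∧q⊆r⇒p∪q⊆r I⊆Q J⊆Q
      ∣A∩B∣≤∣I∩J∣ : ∣ A ∩ B ∣ ≤ ∣ I ∩ J ∣
      ∣A∩B∣≤∣I∩J∣ = +-cancelˡ-≤ ∣ A ∪ B ∣ _ _ (begin
        ∣ A ∪ B ∣ + ∣ A ∩ B ∣  ≡⟨ ∣p∪q∣+∣p∩q∣≡∣p∣+∣q∣ A B ⟩
        ∣ A ∣ + ∣ B ∣          ≤⟨ +-mono-≤ I-tight J-tight ⟩
        ∣ I ∣ + ∣ J ∣          ≡⟨ ∣p∪q∣+∣p∩q∣≡∣p∣+∣q∣ I J ⟨
        ∣ I ∪ J ∣ + ∣ I ∩ J ∣  ≤⟨ +-monoˡ-≤ _ (≤-trans (hall (I ∪ J) I∪J⊆Q) (p⊆q⇒∣p∣≤∣q∣ (neighbours-∪ F I J))) ⟩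
        ∣ A ∪ B ∣ + ∣ I ∩ J ∣  ∎)
        where open ≤-Reasoning

    smallest = minimal-by ∣_∣ tight? Q Q-tight
    J = proj₁ smallest
    J-tight = proj₁ (proj₂ smallest)
    y = proj₁ (proj₁ (proj₂ J-tight))
    y∈J = proj₂ (proj₁ (proj₂ J-tight))
    y∈Q = proj₁ J-tight y∈J

    y∈tight : ∀ {I} → Tight I → y ∈ I
    y∈tight {I} I-tight = proj₁ (x∈p∩q⁻ I J (J⊆I∩J y∈J))
      where
      J⊆I∩J : J ⊆ I ∩ J
      J⊆I∩J = p⊆q∧∣q∣≤∣p∣⇒q⊆p (p∩q⊆q I J) (proj₂ (proj₂ smallest) (I ∩ J) (tight-∩ I-tight J-tight))

    ∣Q-y∣≡∣F-e∣ : ∣ Q - y ∣ ≡ ∣ F - e ∣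
    ∣Q-y∣≡∣F-e∣ = suc-injective (trans (sym (x∈p⇒∣p∣≡1+∣p-x∣ y∈Q)) (trans ∣Q∣≡∣F∣ (x∈p⇒∣p∣≡1+∣p-x∣ e∈F)))

    hall-Q-y : Hall (F - e) (Q - y)
    hall-Q-y I I⊆Q-y = ≤-by-Nonempty λ I≠∅ → ≤-pred (begin-strict
      ∣ I ∣                         <⟨ surplus I≠∅ ⟩
      ∣ neighbours F I ∣            ≡⟨ x∈p⇒∣p∣≡1+∣p-x∣ (e∈neighbours I⊆Q I≠∅) ⟩
      suc ∣ neighbours F I - e ∣    ≡⟨ cong (suc ∘ ∣_∣) (p∩[q─r]≡[p∩q]─r (paths I) F ⁅ e ⁆) ⟨
      suc ∣ neighbours (F - e) I ∣  ∎)
      where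
      open ≤-Reasoning
      I⊆Q : I ⊆ Q
      I⊆Q = p─q⊆p Q ⁅ y ⁆ ∘ I⊆Q-y
      y∉I : y ∉ I
      y∉I y∈I = proj₂ (x∈p─q⁻ Q ⁅ y ⁆ (I⊆Q-y y∈I)) (x∈⁅x⁆ y)
      surplus : Nonempty I → ∣ I ∣ < ∣ neighbours F I ∣
      surplus I≠∅ = ≰⇒> λ not-surplus → y∉I (y∈tight (I⊆Q , I≠∅ , not-surplus))

  Complement : Subset N → Subset m → Subset N → Set
  Complement P F R = R ⊆ P × Perfect F (P ─ R)

  Complement⇒∣P∣≡∣F∣+∣R∣ : ∀ {P F R} → Complement P F R → ∣ P ∣ ≡ ∣ F ∣ + ∣ R ∣
  Complement⇒∣P∣≡∣F∣+∣R∣ {P} {F} {R} (R⊆P , ∣P─R∣≡∣F∣ , _) = begin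
    ∣ P ∣                  ≡⟨ ∣p∣≡∣p∩q∣+∣p─q∣ P R ⟩
    ∣ P ∩ R ∣ + ∣ P ─ R ∣  ≡⟨ cong₂ _+_ (cong ∣_∣ P∩R≡R) ∣P─R∣≡∣F∣ ⟩
    ∣ R ∣ + ∣ F ∣          ≡⟨ +-comm ∣ R ∣ ∣ F ∣ ⟩
    ∣ F ∣ + ∣ R ∣          ∎
    where
    open ≡-Reasoning
    P∩R≡R : P ∩ R ≡ R
    P∩R≡R = ⊆-antisym (p∩q⊆q P R) (λ x∈R → x∈p∩q⁺ (R⊆P x∈R , x∈R))

  ∣Complement∣-unique : ∀ {P F R R'} → Complement P F R → Complement P F R' → ∣ R ∣ ≡ ∣ R' ∣
  ∣Complement∣-unique {F = F} complement complement' =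
    +-cancelˡ-≡ ∣ F ∣ _ _ (trans (sym (Complement⇒∣P∣≡∣F∣+∣R∣ complement)) (Complement⇒∣P∣≡∣F∣+∣R∣ complement'))

  complement-split : ∀ {P F R} T S → Separates T S F → Complement P F R →
                     Complement (P ∩ T) (F ∩ S) (R ∩ T) × Complement (P ─ T) (F ─ S) (R ─ T)
  complement-split {P} {F} {R} T S separates (R⊆P , perfect) =
    (R∩T⊆P∩T , subst (Perfect (F ∩ S)) (sym ([p∩r]─[q∩r]≡[p─q]∩r P R T)) (proj₁ halves)) ,
    (R─T⊆P─T , subst (Perfect (F ─ S)) (sym ([p─r]─[q─r]≡[p─q]─r P R T)) (proj₂ halves))
    where
    halves = perfect-split T S separates perfect
    R∩T⊆P∩T : R ∩ T ⊆ P ∩ T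
    R∩T⊆P∩T x∈ with x∈p∩q⁻ R T x∈
    ... | x∈R , x∈T = x∈p∩q⁺ (R⊆P x∈R , x∈T)
    R─T⊆P─T : R ─ T ⊆ P ─ T
    R─T⊆P─T x∈ with x∈p─q⁻ R T x∈
    ... | x∈R , x∉T = x∈p∧x∉q⇒x∈p─q (R⊆P x∈R) x∉T

  complement-augment : ∀ {P F R e} → Complement P F R → e ∈ F → (∀ {x} → x ∈ P → e ∈ path x) →
                       ∃ λ y → y ∉ R × Complement P (F - e) (R ∪ ⁅ y ⁆)
  complement-augment {P} {F} {R} {e} (R⊆P , perfect) e∈F through-e =
    y , proj₂ (x∈p─q⁻ P R y∈P─R) , R∪⁅y⁆⊆P , subst (Perfect (F - e)) (p─q─r≡p─q∪r P R ⁅ y ⁆) perfect-y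
    where
    removal = perfect-remove perfect e∈F (through-e ∘ p─q⊆p P R)
    y = proj₁ removal
    y∈P─R = proj₁ (proj₂ removal)
    perfect-y = proj₂ (proj₂ removal)
    R∪⁅y⁆⊆P : R ∪ ⁅ y ⁆ ⊆ P
    R∪⁅y⁆⊆P = p⊆r∧q⊆r⇒p∪q⊆r R⊆P (x∈p⇒⁅x⁆⊆p (p─q⊆p P R y∈P─R))

  Height : ℕ → Subset N → Subset m → Set
  Height h P F = ∀ {x} → x ∈ P → ∣ path x ∩ F ∣ ≤ h

  Covered : Subset N → Subset m → Subset N → Set
  Covered P F U = ∀ {u} → u ∈ U → ∃ λ R → Complement P F R × u ∈ R

  CoverBound : Subset N → Subset m → Set
  CoverBound P F = ∀ h → Height h P F → ∀ U → Covered P F U → ∀ R → Complement P F R → ∣ U ∣ ≤ ∣ R ∣ * 2 ^ h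

  height-mono : ∀ {h P P' F F'} → Height h P F → P' ⊆ P → F' ⊆ F → Height h P' F'
  height-mono {F' = F'} height P'⊆P F'⊆F {x} x∈P' = ≤-trans (p⊆q⇒∣p∣≤∣q∣ restrict) (height (P'⊆P x∈P'))
    where
    restrict : path x ∩ F' ⊆ path x ∩ _
    restrict j∈ with x∈p∩q⁻ (path x) F' j∈
    ... | j∈path , j∈F' = x∈p∩q⁺ (j∈path , F'⊆F j∈F')

  covered⊆P : ∀ {P F U} → Covered P F U → U ⊆ P
  covered⊆P covered u∈U with covered u∈U
  ... | R , (R⊆P , _) , u∈R = R⊆P u∈R

  covered⇒0<∣R∣ : ∀ {P F U R} → Covered P F U → Nonempty U → Complement P F R → 0 < ∣ R ∣
  covered⇒0<∣R∣ covered (u , u∈U) complement with covered u∈U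
  ... | R' , complement' , u∈R' = subst (0 <_) (∣Complement∣-unique complement' complement) (x∈p⇒0<∣p∣ u∈R')

  covered-transport : ∀ {P F U P' F' U'} → Covered P F U → U' ⊆ U →
                      (∀ {R} → Complement P F R → ∃ λ R' → Complement P' F' R' × R ∩ U' ⊆ R') → Covered P' F' U'
  covered-transport covered U'⊆U transport {u} u∈U' =
    proj₁ moved , proj₁ (proj₂ moved) , proj₂ (proj₂ moved) (x∈p∩q⁺ (proj₂ (proj₂ cover) , u∈U'))
    where
    cover = covered (U'⊆U u∈U')
    moved = transport (proj₁ (proj₂ cover))

  cover-bound-empty : ∀ {P F} → Empty F → CoverBound P F
  cover-bound-empty {P} {F} F-empty h _ U covered R (_ , ∣P─R∣≡∣F∣ , _) =
    ≤-trans (p⊆q⇒∣p∣≤∣q∣ U⊆R) (n≤n*2^h ∣ R ∣ h)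
    where
    P⊆R : P ⊆ R
    P⊆R = Empty[p─q]⇒p⊆q λ (x , x∈P─R) →
      <⇒≱ (x∈p⇒0<∣p∣ x∈P─R) (≤-reflexive (trans ∣P─R∣≡∣F∣ (Empty⇒∣p∣≡0 F-empty)))
    U⊆R : U ⊆ R
    U⊆R = P⊆R ∘ covered⊆P covered

  cover-bound-through : ∀ {P F e} → e ∈ F → (∀ {x} → x ∈ P → e ∈ path x) →
                        CoverBound P (F - e) → CoverBound P F
  cover-bound-through e∈F through-e _ zero height U covered _ _ = ≤-by-Nonempty λ (u , u∈U) →
    contradiction (height (covered⊆P covered u∈U))
                  (<⇒≱ (x∈p⇒0<∣p∣ (x∈p∩q⁺ (through-e (covered⊆P covered u∈U) , e∈F))))
  cover-bound-through {P} {F} {e} e∈F through-e bound (suc h) height U covered R complement =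
    ≤-by-Nonempty λ U≠∅ → begin
      ∣ U ∣                  ≤⟨ bound h height-e U covered-e (R ∪ ⁅ y ⁆) complement-y ⟩
      ∣ R ∪ ⁅ y ⁆ ∣ * 2 ^ h  ≡⟨ cong (_* 2 ^ h) (x∉p⇒∣p∪⁅x⁆∣≡1+∣p∣ y∉R) ⟩
      suc ∣ R ∣ * 2 ^ h      ≤⟨ [1+n]*a≤n*[2*a] (2 ^ h) (covered⇒0<∣R∣ covered U≠∅ complement) ⟩
      ∣ R ∣ * 2 ^ suc h      ∎
    where
    open ≤-Reasoning
    augmented = complement-augment complement e∈F through-e
    y = proj₁ augmented
    y∉R = proj₁ (proj₂ augmented)
    complement-y = proj₂ (proj₂ augmented)
    height-e : Height h P (F - e)
    height-e {x} x∈P = ≤-pred (begin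
      suc ∣ path x ∩ (F - e) ∣  ≡⟨ cong (suc ∘ ∣_∣) (p∩[q─r]≡[p∩q]─r (path x) F ⁅ e ⁆) ⟩
      suc ∣ path x ∩ F - e ∣    ≡⟨ x∈p⇒∣p∣≡1+∣p-x∣ (x∈p∩q⁺ (through-e x∈P , e∈F)) ⟨
      ∣ path x ∩ F ∣            ≤⟨ height x∈P ⟩
      suc h                     ∎)
    covered-e : Covered P (F - e) U
    covered-e = covered-transport covered id λ {R'} complement' →
      let y' , _ , complement'-y' = complement-augment complement' e∈F through-e
      in R' ∪ ⁅ y' ⁆ , complement'-y' , p⊆p∪q ⁅ y' ⁆ ∘ p∩q⊆p R' U

  cover-bound-split : ∀ {P F} T S → Separates T S F →
                      CoverBound (P ∩ T) (F ∩ S) → CoverBound (P ─ T) (F ─ S) → CoverBound P F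
  cover-bound-split {P} {F} T S separates bound-in bound-out h height U covered R complement = begin
    ∣ U ∣                                  ≡⟨ ∣p∣≡∣p∩q∣+∣p─q∣ U T ⟩
    ∣ U ∩ T ∣ + ∣ U ─ T ∣                  ≤⟨ +-mono-≤ (bound-in h height-in (U ∩ T) covered-in (R ∩ T) (proj₁ (split complement)))
                                                       (bound-out h height-out (U ─ T) covered-out (R ─ T) (proj₂ (split complement))) ⟩
    ∣ R ∩ T ∣ * 2 ^ h + ∣ R ─ T ∣ * 2 ^ h  ≡⟨ *-distribʳ-+ (2 ^ h) ∣ R ∩ T ∣ ∣ R ─ T ∣ ⟨
    (∣ R ∩ T ∣ + ∣ R ─ T ∣) * 2 ^ h        ≡⟨ cong (_* 2 ^ h) (∣p∣≡∣p∩q∣+∣p─q∣ R T) ⟨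
    ∣ R ∣ * 2 ^ h                          ∎
    where
    open ≤-Reasoning
    split : ∀ {R} → Complement P F R → Complement (P ∩ T) (F ∩ S) (R ∩ T) × Complement (P ─ T) (F ─ S) (R ─ T)
    split = complement-split T S separates
    height-in : Height h (P ∩ T) (F ∩ S)
    height-in = height-mono height (p∩q⊆p P T) (p∩q⊆p F S)
    height-out : Height h (P ─ T) (F ─ S)
    height-out = height-mono height (p─q⊆p P T) (p─q⊆p F S)
    covered-in : Covered (P ∩ T) (F ∩ S) (U ∩ T)
    covered-in = covered-transport covered (p∩q⊆p U T) λ {R'} complement' →
      R' ∩ T , proj₁ (split complement') , p∩[q∩r]⊆p∩r
    covered-out : Covered (P ─ T) (F ─ S) (U ─ T)
    covered-out = covered-transport covered (p─q⊆p U T) λ {R'} complement' →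
      R' ─ T , proj₂ (split complement') , p∩[q─r]⊆p─r

  through : Fin m → Subset N
  through e = select (λ x → e ∈? path x)

  ∈-through⁺ : ∀ {e x} → e ∈ path x → x ∈ through e
  ∈-through⁺ {e} = ∈-select⁺ (λ x → e ∈? path x)

  ∈-through⁻ : ∀ {e x} → x ∈ through e → e ∈ path x
  ∈-through⁻ {e} = ∈-select⁻ (λ x → e ∈? path x)

  top-edge-separates : ∀ {F e} → (∀ {j} → j ∈ F → toℕ e ≤ toℕ j) → Separates (through e) (subtree e) F
  top-edge-separates {e = e} e-min {x} {j} j∈path j∈F = mk⇔ to from
    where
    to : x ∈ through e → j ∈ subtree e
    to x∈ with path-chain x (∈-through⁻ x∈) j∈path
    ... | inj₁ j∈subtree-e = j∈subtree-e
    ... | inj₂ e∈subtree-j = subst (_∈ subtree e) (toℕ-injective (≤-antisym (e-min j∈F) (subtree-index e∈subtree-j))) (∈-subtree e)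
    from : j ∈ subtree e → x ∈ through e
    from j∈subtree-e = ∈-through⁺ (path-upward x j∈path j∈subtree-e)

  cover-bound-step : ∀ P F → (∀ P' F' → ∣ P' ∣ + ∣ F' ∣ < ∣ P ∣ + ∣ F ∣ → CoverBound P' F') → CoverBound P F
  cover-bound-step P F smaller with nonempty? F
  ... | no  F-empty = cover-bound-empty F-empty
  ... | yes F≠∅ with min-index F≠∅
  ... | e , e∈F , e-min with nonempty? (P ─ through e)
  ... | no  none-avoid = cover-bound-through e∈F (∈-through⁻ ∘ Empty[p─q]⇒p⊆q none-avoid)
        (smaller P (F - e) (+-monoʳ-< ∣ P ∣ (x∈p⇒∣p-x∣<∣p∣ e∈F)))
  ... | yes some-avoid = cover-bound-split (through e) (subtree e) (top-edge-separates e-min)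
        (smaller _ _ (+-mono-<-≤ (Nonempty[p─q]⇒∣p∩q∣<∣p∣ P _ some-avoid) (∣p∩q∣≤∣p∣ F _)))
        (smaller _ _ (+-mono-≤-< (∣p─q∣≤∣p∣ P _) (p∩q≢∅⇒∣p─q∣<∣p∣ F _ (e , x∈p∩q⁺ (e∈F , ∈-subtree e)))))

  cover-bound : ∀ P F → CoverBound P F
  cover-bound P F = bounded-by (suc (∣ P ∣ + ∣ F ∣)) P F ≤-refl
    where
    bounded-by : ∀ s P F → ∣ P ∣ + ∣ F ∣ < s → CoverBound P F
    bounded-by (suc s) P F <s = cover-bound-step P F λ P' F' lt → bounded-by s P' F' (≤-trans lt (≤-pred <s))

-- Rooted trees

module _ (T : RootedTree) where

  Anc⇒toℕ≤ : ∀ {u w} → Anc T u w → toℕ u ≤ toℕ w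
  Anc⇒toℕ≤ here = ≤-refl
  Anc⇒toℕ≤ {w = suc i} (up a) = ≤-trans (Anc⇒toℕ≤ a) (≤-trans (parent-lt T i) (n≤1+n _))

  Anc-trans : ∀ {u v w} → Anc T u v → Anc T v w → Anc T u w
  Anc-trans u≼v here      = u≼v
  Anc-trans u≼v (up v≼w) = up (Anc-trans u≼v v≼w)

  Anc-connex : ∀ {u v w} → Anc T u w → Anc T v w → Anc T u v ⊎ Anc T v u
  Anc-connex here     v≼w      = inj₂ v≼w
  Anc-connex u≼w      here     = inj₁ u≼w
  Anc-connex (up u≼w) (up v≼w) = Anc-connex u≼w v≼w

  Anc? : ∀ u w → Dec (Anc T u w)
  Anc? u w = bounded (suc (toℕ w)) u w ≤-refl
    where
    bounded : ∀ fuel u w → toℕ w < fuel → Dec (Anc T u w)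
    bounded (suc fuel) u zero    _ with u ≟ zero
    ... | yes refl = yes here
    ... | no  u≢w  = no λ { here → u≢w refl }
    bounded (suc fuel) u (suc i) w<fuel with u ≟ suc i
    ... | yes refl = yes here
    ... | no  u≢w with bounded fuel u (parent T i) (≤-trans (s≤s (parent-lt T i)) (≤-pred w<fuel))
    ... | yes u≼p = yes (up u≼p)
    ... | no  u⋠p = no λ { here → u≢w refl ; (up u≼p) → u⋠p u≼p }

  pathEdges : Vertex T → Subset (edges T)
  pathEdges v = select (λ i → Anc? (suc i) v)

  ∈-pathEdges⁺ : ∀ {i v} → Anc T (suc i) v → i ∈ pathEdges v
  ∈-pathEdges⁺ {v = v} = ∈-select⁺ (λ i → Anc? (suc i) v)

  ∈-pathEdges⁻ : ∀ {i v} → i ∈ pathEdges v → Anc T (suc i) v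
  ∈-pathEdges⁻ {v = v} = ∈-select⁻ (λ i → Anc? (suc i) v)

  subtreeEdges : Fin (edges T) → Subset (edges T)
  subtreeEdges e = select (λ i → Anc? (suc e) (suc i))

  ∈-subtreeEdges⁺ : ∀ {e i} → Anc T (suc e) (suc i) → i ∈ subtreeEdges e
  ∈-subtreeEdges⁺ {e} = ∈-select⁺ (λ i → Anc? (suc e) (suc i))

  ∈-subtreeEdges⁻ : ∀ {e i} → i ∈ subtreeEdges e → Anc T (suc e) (suc i)
  ∈-subtreeEdges⁻ {e} = ∈-select⁻ (λ i → Anc? (suc e) (suc i))

  ∈-subtreeEdges-refl : ∀ e → e ∈ subtreeEdges e
  ∈-subtreeEdges-refl e = ∈-subtreeEdges⁺ here

  subtreeEdges-index : ∀ {e j} → j ∈ subtreeEdges e → toℕ e ≤ toℕ j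
  subtreeEdges-index j∈ = ≤-pred (Anc⇒toℕ≤ (∈-subtreeEdges⁻ j∈))

  pathEdges-upward : ∀ v {e j} → j ∈ pathEdges v → j ∈ subtreeEdges e → e ∈ pathEdges v
  pathEdges-upward v j∈path j∈subtree = ∈-pathEdges⁺ (Anc-trans (∈-subtreeEdges⁻ j∈subtree) (∈-pathEdges⁻ j∈path))

  pathEdges-chain : ∀ v {e j} → e ∈ pathEdges v → j ∈ pathEdges v → j ∈ subtreeEdges e ⊎ e ∈ subtreeEdges j
  pathEdges-chain v e∈ j∈ = Sum.map ∈-subtreeEdges⁺ ∈-subtreeEdges⁺ (Anc-connex (∈-pathEdges⁻ e∈) (∈-pathEdges⁻ j∈))

  PathLen⇒∣pathEdges∣≤ : ∀ {v l} → PathLen T v l → ∣ pathEdges v ∣ ≤ l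
  PathLen⇒∣pathEdges∣≤ root = ≤-reflexive (Empty⇒∣p∣≡0 λ { (i , i∈) → root-has-no-ancestor (∈-pathEdges⁻ i∈) })
    where
    root-has-no-ancestor : ∀ {i} → ¬ Anc T (suc i) zero
    root-has-no-ancestor ()
  PathLen⇒∣pathEdges∣≤ (step {i} {l} len) = begin
    ∣ pathEdges (suc i) ∣                    ≤⟨ p⊆q⇒∣p∣≤∣q∣ split ⟩
    ∣ ⁅ i ⁆ ∪ pathEdges (parent T i) ∣       ≤⟨ ∣p∪q∣≤∣p∣+∣q∣ ⁅ i ⁆ _ ⟩
    ∣ ⁅ i ⁆ ∣ + ∣ pathEdges (parent T i) ∣   ≡⟨ cong (_+ ∣ pathEdges (parent T i) ∣) (∣⁅x⁆∣≡1 i) ⟩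
    suc ∣ pathEdges (parent T i) ∣           ≤⟨ s≤s (PathLen⇒∣pathEdges∣≤ len) ⟩
    suc l                                    ∎
    where
    open ≤-Reasoning
    split : pathEdges (suc i) ⊆ ⁅ i ⁆ ∪ pathEdges (parent T i)
    split {j} j∈ with ∈-pathEdges⁻ j∈
    ... | here   = x∈p∪q⁺ (inj₁ (x∈⁅x⁆ j))
    ... | up j≼p = x∈p∪q⁺ (inj₂ (∈-pathEdges⁺ j≼p))

-- Matroids

module _ (M : Matroid) where

  independent-⊆ : ∀ {X Y} → ∣ X ∣ ≤ r M X → Y ⊆ X → ∣ Y ∣ ≤ r M Y
  independent-⊆ {X} {Y} X-indep Y⊆X = +-cancelʳ-≤ ∣ X ─ Y ∣ ∣ Y ∣ (r M Y) (begin
    ∣ Y ∣ + ∣ X ─ Y ∣                    ≤⟨ +-monoˡ-≤ _ (p⊆q⇒∣p∣≤∣q∣ (λ y∈Y → x∈p∩q⁺ (Y⊆X y∈Y , y∈Y))) ⟩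
    ∣ X ∩ Y ∣ + ∣ X ─ Y ∣                ≡⟨ ∣p∣≡∣p∩q∣+∣p─q∣ X Y ⟨
    ∣ X ∣                                ≤⟨ X-indep ⟩
    r M X                                ≤⟨ r-mono M X⊆Y∪[X─Y] ⟩
    r M (Y ∪ (X ─ Y))                    ≤⟨ m≤m+n _ _ ⟩
    r M (Y ∪ (X ─ Y)) + r M (Y ∩ (X ─ Y)) ≤⟨ r-submod M Y (X ─ Y) ⟩
    r M Y + r M (X ─ Y)                  ≤⟨ +-monoʳ-≤ (r M Y) (r-bounded M (X ─ Y)) ⟩
    r M Y + ∣ X ─ Y ∣                    ∎)
    where
    open ≤-Reasoning
    X⊆Y∪[X─Y] : X ⊆ Y ∪ (X ─ Y)
    X⊆Y∪[X─Y] {x} x∈X with x ∈? Y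
    ... | yes x∈Y = x∈p∪q⁺ (inj₁ x∈Y)
    ... | no  x∉Y = x∈p∪q⁺ (inj₂ (x∈p∧x∉q⇒x∈p─q x∈X x∉Y))

  closed⇒rank-maximal : ∀ {B} → (∀ e → r M (B ∪ ⁅ e ⁆) ≤ r M B) → ∀ S → r M (B ∪ S) ≤ r M B
  closed⇒rank-maximal {B} closed S = go S (⊂-wellFounded S)
    where
    go : ∀ S → Acc _⊂_ S → r M (B ∪ S) ≤ r M B
    go S (acc smaller) with nonempty? S
    ... | no  S-empty = r-mono M B∪S⊆B
      where
      B∪S⊆B : B ∪ S ⊆ B
      B∪S⊆B {x} x∈ with x∈p∪q⁻ B S x∈
      ... | inj₁ x∈B = x∈B
      ... | inj₂ x∈S = contradiction (x , x∈S) S-empty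
    ... | yes (e , e∈S) = ≤-trans (r-mono M B∪S⊆X∪Y) (+-cancelʳ-≤ (r M B) _ _ (begin
      r M (X ∪ Y) + r M B       ≤⟨ +-monoʳ-≤ _ (r-mono M B⊆X∩Y) ⟩
      r M (X ∪ Y) + r M (X ∩ Y) ≤⟨ r-submod M X Y ⟩
      r M X + r M Y             ≤⟨ +-mono-≤ (go (S - e) (smaller (x∈p⇒p-x⊂p e∈S))) (closed e) ⟩
      r M B + r M B             ∎))
      where
      open ≤-Reasoning
      X = B ∪ (S - e)
      Y = B ∪ ⁅ e ⁆
      B⊆X∩Y : B ⊆ X ∩ Y
      B⊆X∩Y x∈B = x∈p∩q⁺ (p⊆p∪q _ x∈B , p⊆p∪q _ x∈B)
      B∪S⊆X∪Y : B ∪ S ⊆ X ∪ Y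
      B∪S⊆X∪Y {x} x∈ with x∈p∪q⁻ B S x∈ | x ≟ e
      ... | inj₁ x∈B | _        = p⊆p∪q Y (p⊆p∪q _ x∈B)
      ... | inj₂ x∈S | yes refl = q⊆p∪q X Y (q⊆p∪q B _ (x∈⁅x⁆ x))
      ... | inj₂ x∈S | no  x≢e  = p⊆p∪q Y (q⊆p∪q B _ (x∈p∧x≢y⇒x∈p-y x∈S x≢e))

  extend-to-basis : ∀ {I} → ∣ I ∣ ≤ r M I → ∃ λ B → I ⊆ B × ∣ B ∣ ≤ r M B × r M ⊤ ≤ r M B
  extend-to-basis {I} I-indep = B , I⊆B , B-indep , B-spanning
    where
    Extends : Subset (n M) → Set
    Extends B = I ⊆ B × ∣ B ∣ ≤ r M B
    largest = minimal-by (∣_∣ ∘ ∁) (λ B → (I ⊆? B) ×-dec (∣ B ∣ ≤? r M B)) I (id , I-indep)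
    B = proj₁ largest
    I⊆B = proj₁ (proj₁ (proj₂ largest))
    B-indep = proj₂ (proj₁ (proj₂ largest))
    B-largest : ∀ B' → Extends B' → ∣ B' ∣ ≤ ∣ B ∣
    B-largest B' ext = +-cancelʳ-≤ ∣ ∁ B ∣ _ _ (begin
      ∣ B' ∣ + ∣ ∁ B ∣   ≤⟨ +-monoʳ-≤ ∣ B' ∣ (proj₂ (proj₂ largest) B' ext) ⟩
      ∣ B' ∣ + ∣ ∁ B' ∣  ≡⟨ trans (∣p∣+∣∁p∣≡n B') (sym (∣p∣+∣∁p∣≡n B)) ⟩
      ∣ B ∣ + ∣ ∁ B ∣    ∎)
      where open ≤-Reasoning
    closed : ∀ e → r M (B ∪ ⁅ e ⁆) ≤ r M B
    closed e with e ∈? B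
    ... | yes e∈B = r-mono M (p⊆r∧q⊆r⇒p∪q⊆r id (x∈p⇒⁅x⁆⊆p e∈B))
    ... | no  e∉B = ≤-trans (≮⇒≥ extension-fails) B-indep
      where
      extension-fails : ¬ ∣ B ∣ < r M (B ∪ ⁅ e ⁆)
      extension-fails ∣B∣<r = <⇒≱ (≤-reflexive (sym (x∉p⇒∣p∪⁅x⁆∣≡1+∣p∣ e∉B)))
        (B-largest (B ∪ ⁅ e ⁆) (p⊆p∪q _ ∘ I⊆B , subst (_≤ r M (B ∪ ⁅ e ⁆)) (sym (x∉p⇒∣p∪⁅x⁆∣≡1+∣p∣ e∉B)) ∣B∣<r))
    B-spanning : r M ⊤ ≤ r M B
    B-spanning = ≤-trans (r-mono M (q⊆p∪q B ⊤)) (closed⇒rank-maximal closed ⊤)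

  circuit-exchange : ∀ {C B x₀ c} → IsCircuit M C → x₀ ∈ C → C - x₀ ⊆ B → ∣ B ∣ ≤ r M B → c ∈ C →
                     ∣ B ∪ ⁅ x₀ ⁆ - c ∣ ≡ ∣ B ∣ × ∣ B ∪ ⁅ x₀ ⁆ - c ∣ ≤ r M (B ∪ ⁅ x₀ ⁆ - c)
  circuit-exchange {C} {B} {x₀} {c} (dependent , minimal) x₀∈C C-x₀⊆B B-indep c∈C = ∣W∣≡∣B∣ , W-indep
    where
    D = B ∪ ⁅ x₀ ⁆
    W = D - c
    C⊆D : C ⊆ D
    C⊆D = p-x⊆q⇒p⊆q∪⁅x⁆ C-x₀⊆B
    x₀∉B : x₀ ∉ B
    x₀∉B x₀∈B = <⇒≱ dependent (independent-⊆ B-indep (p⊆r∧q⊆r⇒p∪q⊆r id (x∈p⇒⁅x⁆⊆p x₀∈B) ∘ C⊆D))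
    ∣W∣≡∣B∣ : ∣ W ∣ ≡ ∣ B ∣
    ∣W∣≡∣B∣ = suc-injective (trans (sym (x∈p⇒∣p∣≡1+∣p-x∣ (C⊆D c∈C))) (x∉p⇒∣p∪⁅x⁆∣≡1+∣p∣ x₀∉B))
    B⊆W∪C : B ⊆ W ∪ C
    B⊆W∪C {x} x∈B with x ≟ c
    ... | yes refl = q⊆p∪q W C c∈C
    ... | no  x≢c  = p⊆p∪q C (x∈p∧x≢y⇒x∈p-y (p⊆p∪q _ x∈B) x≢c)
    C-c⊆W∩C : C - c ⊆ W ∩ C
    C-c⊆W∩C x∈ with x∈p─q⁻ C ⁅ c ⁆ x∈
    ... | x∈C , x∉⁅c⁆ = x∈p∩q⁺ (x∈p∧x∉q⇒x∈p─q (C⊆D x∈C) x∉⁅c⁆ , x∈C)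
    rC≤r[W∩C] : r M C ≤ r M (W ∩ C)
    rC≤r[W∩C] = begin
      r M C          ≤⟨ ≤-pred (≤-trans dependent (≤-reflexive (x∈p⇒∣p∣≡1+∣p-x∣ c∈C))) ⟩
      ∣ C - c ∣      ≡⟨ minimal (C - c) (x∈p⇒p-x⊂p c∈C) ⟨
      r M (C - c)    ≤⟨ r-mono M C-c⊆W∩C ⟩
      r M (W ∩ C)    ∎
      where open ≤-Reasoning
    W-indep : ∣ W ∣ ≤ r M W
    W-indep = begin
      ∣ W ∣          ≡⟨ ∣W∣≡∣B∣ ⟩
      ∣ B ∣          ≤⟨ B-indep ⟩
      r M B          ≤⟨ r-mono M B⊆W∪C ⟩
      r M (W ∪ C)    ≤⟨ +-cancelʳ-≤ (r M C) _ _ (≤-trans (+-monoʳ-≤ _ rC≤r[W∩C]) (r-submod M W C)) ⟩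
      r M W          ∎
      where open ≤-Reasoning

-- Depth-decompositions

module _ (M : Matroid) (T : RootedTree) (decomposition : DepthDecomposition M T) where
  open DepthDecomposition decomposition

  path : Fin (n M) → Subset (edges T)
  path x = pathEdges T (f x)

  open PathCounting path (subtreeEdges T) (∈-subtreeEdges-refl T) (pathEdges-upward T ∘ f)
                    (pathEdges-chain T ∘ f) (subtreeEdges-index T)

  paths-IsTStar : ∀ X → IsTStar M T f X (paths X)
  paths-IsTStar X i = mk⇔ (λ i∈ → let x , x∈X , i∈path = ∈-paths⁻ i∈ in x , x∈X , ∈-pathEdges⁻ T i∈path)
                          (λ (x , x∈X , i≼fx) → ∈-paths⁺ x∈X (∈-pathEdges⁺ T i≼fx))

  independent⇒Hall : ∀ {X} → ∣ X ∣ ≤ r M X → Hall ⊤ X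
  independent⇒Hall X-indep I I⊆X = begin
    ∣ I ∣                ≤⟨ independent-⊆ M X-indep I⊆X ⟩
    r M I                ≤⟨ rankX I (paths I) (paths-IsTStar I) ⟩
    ∣ paths I ∣          ≡⟨ cong ∣_∣ (∩-identityʳ (paths I)) ⟨
    ∣ neighbours ⊤ I ∣   ∎
    where open ≤-Reasoning

  Depth⇒Height : ∀ {b P} → Depth T b → Height b P ⊤
  Depth⇒Height (path-lengths , _) {x} _ with path-lengths (f x)
  ... | l , len , l≤b = ≤-trans (∣p∩q∣≤∣p∣ (path x) ⊤) (≤-trans (PathLen⇒∣pathEdges∣≤ T len) l≤b)

  circuit-size≤2^depth : ∀ {b C} → Depth T b → IsCircuit M C → ∣ C ∣ ≤ 2 ^ b
  circuit-size≤2^depth {b} {C} depth circuit@(dependent , minimal) = begin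
    ∣ C ∣               ≤⟨ cover-bound D ⊤ b (Depth⇒Height depth) C covered ⁅ x₀ ⁆ (complement x₀∈C) ⟩
    ∣ ⁅ x₀ ⁆ ∣ * 2 ^ b  ≡⟨ cong (_* 2 ^ b) (∣⁅x⁆∣≡1 x₀) ⟩
    1 * 2 ^ b           ≡⟨ *-identityˡ (2 ^ b) ⟩
    2 ^ b               ∎
    where
    open ≤-Reasoning
    C≠∅ = 0<∣p∣⇒Nonempty (≤-<-trans z≤n dependent)
    x₀ = proj₁ C≠∅
    x₀∈C = proj₂ C≠∅
    basis = extend-to-basis M (≤-reflexive (sym (minimal (C - x₀) (x∈p⇒p-x⊂p x₀∈C))))
    B = proj₁ basis
    C-x₀⊆B = proj₁ (proj₂ basis)
    B-indep = proj₁ (proj₂ (proj₂ basis))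
    B-spanning = proj₂ (proj₂ (proj₂ basis))
    D = B ∪ ⁅ x₀ ⁆
    ∣B∣≡∣⊤∣ : ∣ B ∣ ≡ ∣ ⊤ {edges T} ∣
    ∣B∣≡∣⊤∣ = trans (≤-antisym (≤-trans B-indep (r-mono M ⊆⊤)) (≤-trans B-spanning (r-bounded M B)))
                    (trans rankM (sym (∣⊤∣≡n (edges T))))
    complement : ∀ {c} → c ∈ C → Complement D ⊤ ⁅ c ⁆
    complement c∈C =
      x∈p⇒⁅x⁆⊆p (p-x⊆q⇒p⊆q∪⁅x⁆ C-x₀⊆B c∈C) , trans (proj₁ exchange) ∣B∣≡∣⊤∣ , independent⇒Hall (proj₂ exchange)
      where exchange = circuit-exchange M circuit x₀∈C C-x₀⊆B B-indep c∈C
    covered : Covered D ⊤ C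
    covered c∈C = ⁅ _ ⁆ , complement c∈C , x∈⁅x⁆ _

proposition9 : (M : Matroid) → HasCircuit M → (d : ℕ) → LargestCircuitSize M d →
    (b : ℕ) → IsBranchDepth M b → d ≤ 2 ^ b
proposition9 M _ d ((C , circuit , ∣C∣≡d) , _) b ((T , decomposition , depth) , _) =
  subst (_≤ 2 ^ b) ∣C∣≡d (circuit-size≤2^depth M T decomposition depth circuit)
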